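{- Suppose $\sigma \in L(\mathcal Q_\delta)$. Then $\sigma$ is allowed by $\mathcal S$ under quiescent consistency iff $\sigma \in \mathcal L_U(\mathcal S_\delta)$.
   Context: $\mathcal S$ (specification) and $\mathcal Q$ (implementation) are finite automata over an alphabet $\Sigma$ of invocation and response events, each associated with a process; an invocation matches a response iff they have the same process and operation. A run is sequential if (when non-empty) it starts with an invocation, each invocation at an even position $i<k$ is immediately followed by its matching response, and a final event at an even position is an invocation; legal if its restriction to each process is sequential. An invocation is pending if no later matching response occurs; a run is quiescent if it has no pending invocations; end-to-end quiescent if quiescent with no quiescent non-empty proper prefix. $\mathcal S$ is sequential, all runs of $\mathcal S,\mathcal Q$ are legal, and a path from the initial state is quiescent iff it ends in a final state. $\delta\notin\Sigma$ marks quiescence: $\mathcal S_\delta$ adds a self-loop $(s,\delta,s)$ at each quiescent state $s$ of $\mathcal S$; $\mathcal Q_\delta$ replaces each quiescent state $q$ of $\mathcal Q$ by $q$ with a single transition $(q,\delta,q_\delta)$ to a new state $q_\delta$ from which all original outgoing transitions of $q$ leave ($q_\delta$ final instead of $q$ if $q$ was final). $U=\Sigma\times\Sigma$ (so $\delta$ commutes with nothing), and $\mathcal L_U(\mathcal M)$ is the set of runs obtained from runs of $L(\mathcal M)$ by repeatedly swapping adjacent independent events. A legal quiescent run $\sigma=\sigma_1\cdots\sigma_k$ with each $\sigma_i$ legal and end-to-end quiescent is allowed by $\mathcal S$ under quiescent consistency iff there are permutations $\sigma_i'$ of $\sigma_i$ with $\sigma_1'\cdots\sigma_k'\in L(\mathcal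 S)$; a run of $\mathcal Q_\delta$ is allowed iff it is so after deleting all $\delta$. -}

module Defs where

open import Data.Nat using (ℕ)
open import Data.Fin using (Fin)
open import Data.Bool using (Bool; T)
open import Data.List using (List; []; _∷_; _++_; [_]; concat; filter; mapMaybe)
open import Data.List.Relation.Unary.All using (All)
open import Data.List.Relation.Unary.Any using (Any)
open import Data.List.Relation.Binary.Pointwise using (Pointwise)
open import Data.List.Relation.Binary.Permutation.Propositional using (_↭_)
open import Data.Maybe using (Maybe; just; nothing)
open import Data.Product using (Σ; ∃; ∃-syntax; _×_; _,_)
open import Data.Sum using (_⊎_; inj₁; inj₂)
open import Data.Empty using (⊥)
open import Relation.Nullary using (¬_)
open import Relation.Binary.PropositionalEquality using (_≡_; _≢_)
open import Relation.Binary.Definitions using (DecidableEquality)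
open import Relation.Binary.Construct.Closure.ReflexiveTransitive using (Star)
open import Function.Bundles using (_⇔_)

data Kind : Set where
  inv res : Kind

record EventSig : Set₁ where
  field
    size  : ℕ
    Proc  : Set
    _≟P_  : DecidableEquality Proc
    Op    : Set
    kind  : Fin size → Kind
    proc  : Fin size → Proc
    op    : Fin size → Op

  Event : Set
  Event = Fin size

-- Alphabet extended by the quiescence marker δ ∉ Σ.
data Ext (A : Set) : Set where
  ev : A → Ext A
  δ  : Ext A

record Automaton (A : Set) : Set₁ where
  field
    State : Set
    init  : State
    Trans : State → A → State → Set
    Final : State → Set

module _ {A : Set} (M : Automaton A) where
  open Automaton M

  data Path : State → List A → State → Set where
    []  : ∀ {q} → Path q [] q
    _∷_ : ∀ {q a q' w q''} → Trans q a q' → Path q' w q'' → Path q (a ∷ w) q''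

  Run : List A → Set
  Run w = ∃[ q ] Path init w q

  Lang : List A → Set
  Lang w = ∃[ q ] (Path init w q × Final q)

record FinAut (A : Set) : Set where
  field
    n     : ℕ
    init  : Fin n
    trans : Fin n → A → Fin n → Bool
    final : Fin n → Bool

  aut : Automaton A
  aut = record { State = Fin n ; init = init
               ; Trans = λ q a q' → T (trans q a q')
               ; Final = λ q → T (final q) }

module Events (E : EventSig) where
  open EventSig E

  Matches : Event → Event → Set
  Matches a b = kind a ≡ inv × kind b ≡ res × proc a ≡ proc b × op a ≡ op b

  data Sequential : List Event → Set where
    []   : Sequential []
    last : ∀ {a} → kind a ≡ inv → Sequential [ a ]
    pair : ∀ {a b w} → Matches a b → Sequential w → Sequential (a ∷ b ∷ w)

  restrict : Proc → List Event → List Event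
  restrict p = filter (λ e → proc e ≟P p)

  Legal : List Event → Set
  Legal w = ∀ p → Sequential (restrict p w)

  -- the invocation a at position |u| of u ++ a ∷ v is pending
  Pending : List Event → Event → List Event → Set
  Pending u a v = kind a ≡ inv × ¬ Any (Matches a) v

  Quiescent : List Event → Set
  Quiescent w = ∀ u a v → w ≡ u ++ a ∷ v → ¬ Pending u a v

  EndToEndQuiescent : List Event → Set
  EndToEndQuiescent w =
    Quiescent w × (∀ u v → w ≡ u ++ v → u ≢ [] → v ≢ [] → ¬ Quiescent u)

  AllowedQC : FinAut Event → List Event → Set
  AllowedQC S σ =
    Legal σ × Quiescent σ ×
    ∃[ bs ] (concat bs ≡ σ ×
             All (λ b → Legal b × EndToEndQuiescent b) bs ×
             ∃[ bs' ] (Pointwise _↭_ bs bs' × Lang (FinAut.aut S) (concat bs')))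

  eraseδ : List (Ext Event) → List Event
  eraseδ = mapMaybe f
    where
    f : Ext Event → Maybe Event
    f (ev a) = just a
    f δ      = nothing

  AllowedQCδ : FinAut Event → List (Ext Event) → Set
  AllowedQCδ S σ = AllowedQC S (eraseδ σ)

  QuiescentState : (M : Automaton Event) → Automaton.State M → Set
  QuiescentState M q = ∃[ w ] (Path M (Automaton.init M) w q × Quiescent w)

  Sδ : FinAut Event → Automaton (Ext Event)
  Sδ S = record { State = State ; init = init ; Trans = Tr ; Final = Final }
    where
    open Automaton (FinAut.aut S)
    Tr : State → Ext Event → State → Set
    Tr s (ev a) s' = Trans s a s'
    Tr s δ      s' = s ≡ s' × QuiescentState (FinAut.aut S) s

  -- Q_δ : states inj₁ q (original) and inj₂ q (the new state q_δ)
  Qδ : FinAut Event → Automaton (Ext Event)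
  Qδ Q = record { State = State ⊎ State ; init = inj₁ init ; Trans = Tr ; Final = Fin' }
    where
    open Automaton (FinAut.aut Q)
    QS = QuiescentState (FinAut.aut Q)
    Tr : State ⊎ State → Ext Event → State ⊎ State → Set
    Tr (inj₁ q) (ev a) (inj₁ q') = ¬ QS q × Trans q a q'
    Tr (inj₁ q) δ      (inj₂ q') = QS q × q ≡ q'
    Tr (inj₂ q) (ev a) (inj₁ q') = QS q × Trans q a q'
    Tr _        _      _         = ⊥
    Fin' : State ⊎ State → Set
    Fin' (inj₁ q) = Final q × ¬ QS q
    Fin' (inj₂ q) = Final q × QS q

  PathQuiescentIffFinal : FinAut Event → Set
  PathQuiescentIffFinal M =
    ∀ {q w} → Path (FinAut.aut M) (FinAut.init M) w q →
      Quiescent w ⇔ T (FinAut.final M q)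

  AllRunsLegal : FinAut Event → Set
  AllRunsLegal M = ∀ w → Run (FinAut.aut M) w → Legal w

  IsSequentialAut : FinAut Event → Set
  IsSequentialAut M = ∀ w → Run (FinAut.aut M) w → Sequential w

  record Assumptions (S Q : FinAut Event) : Set where
    field
      S-sequential : IsSequentialAut S
      S-legal      : AllRunsLegal S
      Q-legal      : AllRunsLegal Q
      S-quiescent  : PathQuiescentIffFinal S
      Q-quiescent  : PathQuiescentIffFinal Q

-- Partial-order reduction closure L_U with U = Σ × Σ (δ commutes with nothing)

module _ {A : Set} where
  data SwapStep : List (Ext A) → List (Ext A) → Set where
    swap : ∀ u a b v → SwapStep (u ++ ev a ∷ ev b ∷ v) (u ++ ev b ∷ ev a ∷ v)

  LangU : Automaton (Ext A) → List (Ext A) → Set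
  LangU M w = ∃[ w₀ ] (Lang M w₀ × Star SwapStep w₀ w)

module Submission where

-- A word over Σ ∪ {δ} is a sequence of δ-free blocks separated by δ.
-- Swapping adjacent Σ-events (the closure L_U) permutes inside blocks, and
-- conversely every blockwise permutation is a sequence of swaps (section
-- "δ-words and their blocks").  For legal words, quiescence means that each
-- process performs an even number of events, so it is invariant under
-- permutation (section "Legality and quiescence").  An accepted run σ of
-- Q_δ reads δ exactly at the first quiescent point after each block, hence
-- its blocks are legal and end-to-end quiescent (section "Runs of Q_δ").
--   (⇐) A run w₀ of S_δ swapped into σ erases to an S-run whose blocks are
--       permutations of the blocks of σ, so σ is allowed.
--   (⇒) End-to-end quiescent decompositions of a word are unique up to empty
--       blocks, so allowedness permutes the blocks of σ into an S-run.  At a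
--       block boundary that S-prefix is a legal permutation of a legal
--       quiescent word, hence quiescent, and δ may be inserted there
--       (section "Runs of S_δ").

open import Defs
open import Data.List using (List)
open import Function.Bundles using (_⇔_)

open import Data.Nat using (ℕ; suc)
open import Data.Empty using (⊥; ⊥-elim)
open import Data.List using ([]; _∷_; _++_; [_]; concat; filter; length)
open import Data.List.Properties
  using (++-assoc; ++-identityʳ; ++-conicalˡ; ++-conicalʳ; ∷-injectiveˡ; ∷-injectiveʳ;
         filter-++; filter-accept)
open import Data.List.Relation.Unary.All as All using (All; []; _∷_)
open import Data.List.Relation.Unary.Any using (Any; here)
open import Data.List.Relation.Unary.Any.Properties using (¬Any[]; filter⁺; filter⁻; lookup-result; ++⁺ˡ)
open import Data.List.Relation.Binary.Pointwise as Pointwise using (Pointwise; []; _∷_)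
open import Data.List.Relation.Binary.Permutation.Propositional as ↭
  using (_↭_; ↭-refl; ↭-sym; ↭-trans)
open import Data.List.Relation.Binary.Permutation.Propositional.Properties
  using (↭-length; ++⁺; filter-↭; ↭-empty-inv)
open import Data.Product using (∃-syntax; _×_; _,_; proj₁; proj₂)
open import Data.Sum using (_⊎_; inj₁; inj₂)
open import Relation.Nullary using (¬_; yes; no)
open import Relation.Unary using (Decidable)
open import Relation.Binary.PropositionalEquality
  using (_≡_; _≢_; refl; sym; trans; cong; subst)
open import Relation.Binary.Construct.Closure.ReflexiveTransitive
  using (Star; ε; _◅_; _◅◅_; gmap)
open import Function.Bundles using (Equivalence; mk⇔)

private
  variable
    A : Set
    n : ℕ

data Even : ℕ → Set where
  even-0  : Even 0
  even-+2 : Even n → Even (suc (suc n))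

data Odd : ℕ → Set where
  odd-1  : Odd 1
  odd-+2 : Odd n → Odd (suc (suc n))

even-odd-disjoint : Even n → Odd n → ⊥
even-odd-disjoint (even-+2 e) (odd-+2 o) = even-odd-disjoint e o

++-overlap : (b x d y : List A) → b ++ x ≡ d ++ y →
  (∃[ z ] (d ≡ b ++ z × x ≡ z ++ y)) ⊎ (∃[ z ] (b ≡ d ++ z × y ≡ z ++ x))
++-overlap []      x d       y eq = inj₁ (d , refl , eq)
++-overlap (c ∷ b) x []      y eq = inj₂ (c ∷ b , refl , sym eq)
++-overlap (c ∷ b) x (_ ∷ d) y eq with ∷-injectiveˡ eq | ++-overlap b x d y (∷-injectiveʳ eq)
... | refl | inj₁ (z , d≡ , x≡) = inj₁ (z , cong (c ∷_) d≡ , x≡)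
... | refl | inj₂ (z , b≡ , y≡) = inj₂ (z , cong (c ∷_) b≡ , y≡)

filter-occurrence : {P : A → Set} (P? : Decidable P) (w y : List A) {a : A} {z : List A} →
  filter P? w ≡ y ++ a ∷ z → ∃[ u ] ∃[ v ] (w ≡ u ++ a ∷ v × filter P? v ≡ z × P a)
filter-occurrence P? [] [] ()
filter-occurrence P? [] (_ ∷ _) ()
filter-occurrence P? (c ∷ w) y eq with P? c
... | no ¬Pc =
  let (u , v , w≡ , fv , Pa) = filter-occurrence P? w y eq
  in c ∷ u , v , cong (c ∷_) w≡ , fv , Pa
... | yes Pc with y | eq
...   | []     | refl = [] , w , refl , refl , Pc
...   | _ ∷ y' | eq'  =
  let (u , v , w≡ , fv , Pa) = filter-occurrence P? w y' (∷-injectiveʳ eq')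
  in c ∷ u , v , cong (c ∷_) w≡ , fv , Pa

module _ {M : Automaton A} where

  path-++ : ∀ {q w q' w' q''} → Path M q w q' → Path M q' w' q'' → Path M q (w ++ w') q''
  path-++ []      p' = p'
  path-++ (t ∷ p) p' = t ∷ path-++ p p'

  path-split : ∀ {q q''} w {w'} → Path M q (w ++ w') q'' →
    ∃[ q' ] (Path M q w q' × Path M q' w' q'')
  path-split []      p       = _ , [] , p
  path-split (a ∷ w) (t ∷ p) = let (q' , p₁ , p₂) = path-split w p in q' , t ∷ p₁ , p₂

splitδ : List (Ext A) → List A × List (List A)
splitδ []         = [] , []
splitδ (ev a ∷ x) = a ∷ proj₁ (splitδ x) , proj₂ (splitδ x)
splitδ (δ ∷ x)    = [] , proj₁ (splitδ x) ∷ proj₂ (splitδ x)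

blocks : List (Ext A) → List (List A)
blocks x = proj₁ (splitδ x) ∷ proj₂ (splitδ x)

_▸_ : List A → List (Ext A) → List (Ext A)
[]      ▸ r = r
(a ∷ b) ▸ r = ev a ∷ (b ▸ r)

δ-unblocks : List (List A) → List (Ext A)
δ-unblocks []       = []
δ-unblocks (b ∷ bs) = δ ∷ (b ▸ δ-unblocks bs)

unblocks : List (List A) → List (Ext A)
unblocks []       = []
unblocks (b ∷ bs) = b ▸ δ-unblocks bs

unblocks-blocks : (x : List (Ext A)) → unblocks (blocks x) ≡ x
unblocks-blocks []         = refl
unblocks-blocks (ev a ∷ x) = cong (ev a ∷_) (unblocks-blocks x)
unblocks-blocks (δ ∷ x)    = cong (δ ∷_) (unblocks-blocks x)

swap-blockwise : ∀ {x y : List (Ext A)} → SwapStep x y → Pointwise _↭_ (blocks x) (blocks y)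
swap-blockwise (swap u a b v) = go u
  where
  go : ∀ u → Pointwise _↭_ (blocks (u ++ ev a ∷ ev b ∷ v)) (blocks (u ++ ev b ∷ ev a ∷ v))
  go []         = ↭.swap a b ↭-refl ∷ Pointwise.refl ↭-refl
  go (ev c ∷ u) with go u
  ... | p ∷ ps = ↭.prep c p ∷ ps
  go (δ ∷ u)    = ↭-refl ∷ go u

swaps-blockwise : ∀ {x y : List (Ext A)} → Star SwapStep x y → Pointwise _↭_ (blocks x) (blocks y)
swaps-blockwise ε        = Pointwise.refl ↭-refl
swaps-blockwise (s ◅ ss) = Pointwise.transitive ↭-trans (swap-blockwise s) (swaps-blockwise ss)

∷-swaps : ∀ e {x y : List (Ext A)} → Star SwapStep x y → Star SwapStep (e ∷ x) (e ∷ y)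
∷-swaps e = gmap (e ∷_) λ { (swap u a b v) → swap (e ∷ u) a b v }

▸-swaps : ∀ (b : List A) {r r'} → Star SwapStep r r' → Star SwapStep (b ▸ r) (b ▸ r')
▸-swaps []      s = s
▸-swaps (a ∷ b) s = ∷-swaps (ev a) (▸-swaps b s)

↭-swaps : ∀ {b c : List A} → b ↭ c → ∀ r → Star SwapStep (b ▸ r) (c ▸ r)
↭-swaps ↭.refl             r = ε
↭-swaps (↭.prep a p)       r = ∷-swaps (ev a) (↭-swaps p r)
↭-swaps (↭.swap {b} a a' p) r =
  swap [] a a' (b ▸ r) ◅ ∷-swaps (ev a') (∷-swaps (ev a) (↭-swaps p r))
↭-swaps (↭.trans p q)      r = ↭-swaps p r ◅◅ ↭-swaps q r

block-swaps : ∀ {b c : List A} {r r'} → b ↭ c → Star SwapStep r r' → Star SwapStep (b ▸ r) (c ▸ r')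
block-swaps {c = c} p s = ↭-swaps p _ ◅◅ ▸-swaps c s

δ-blockwise-swaps : ∀ {bs cs : List (List A)} → Pointwise _↭_ bs cs →
  Star SwapStep (δ-unblocks bs) (δ-unblocks cs)
δ-blockwise-swaps []       = ε
δ-blockwise-swaps (p ∷ ps) = ∷-swaps δ (block-swaps p (δ-blockwise-swaps ps))

blockwise-swaps : ∀ {bs cs : List (List A)} → Pointwise _↭_ bs cs →
  Star SwapStep (unblocks bs) (unblocks cs)
blockwise-swaps []       = ε
blockwise-swaps (p ∷ ps) = block-swaps p (δ-blockwise-swaps ps)

concat-↭ : ∀ {bs cs : List (List A)} → Pointwise _↭_ bs cs → concat bs ↭ concat cs
concat-↭ []       = ↭-refl
concat-↭ (p ∷ ps) = ++⁺ p (concat-↭ ps)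

-- A property P pre b of every block b, relative to the prefix pre before it.
data Blockwise (P : List A → List A → Set) : List A → List (List A) → Set where
  []  : ∀ {pre} → Blockwise P pre []
  _∷_ : ∀ {pre b bs} → P pre b → Blockwise P (pre ++ b) bs → Blockwise P pre (b ∷ bs)

module EventTheory (E : EventSig) where
  open EventSig E
  open Events E

  private
    variable
      a : Event
      u v w x y pre : List Event

  inv≢res : inv ≢ res
  inv≢res ()

  of? : (p : Proc) → Decidable (λ e → proc e ≡ p)
  of? p e = proc e ≟P p

  sequential-even-or-open : Sequential w → Even (length w) ⊎ ∃[ w' ] ∃[ a ] (w ≡ w' ++ [ a ] × kind a ≡ inv)
  sequential-even-or-open []          = inj₁ even-0
  sequential-even-or-open (last {a} k) = inj₂ ([] , a , refl , k)
  sequential-even-or-open (pair {a} {b} m s) with sequential-even-or-open s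
  ... | inj₁ e                   = inj₁ (even-+2 e)
  ... | inj₂ (w' , a' , refl , k) = inj₂ (a ∷ b ∷ w' , a' , refl , k)

  sequential-pending-odd : ∀ x → Sequential (x ++ a ∷ y) → kind a ≡ inv → ¬ Any (Matches a) y →
    Odd (length (x ++ a ∷ y))
  sequential-pending-odd []          (last _)   _ _  = odd-1
  sequential-pending-odd []          (pair m _) _ nm = ⊥-elim (nm (here m))
  sequential-pending-odd (_ ∷ [])    (pair m _) k _  = ⊥-elim (inv≢res (trans (sym k) (proj₁ (proj₂ m))))
  sequential-pending-odd (_ ∷ _ ∷ x) (pair _ s) k nm = odd-+2 (sequential-pending-odd x s k nm)

  sequential-drop : ∀ x → Even (length x) → Sequential (x ++ y) → Sequential y
  sequential-drop []          _           s          = s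
  sequential-drop (_ ∷ _ ∷ x) (even-+2 e) (pair _ s) = sequential-drop x e s

  -- Quiescence as parity: in a legal quiescent word every process performs
  -- an even number of events ...
  quiescent⇒even : Legal w → Quiescent w → ∀ p → Even (length (restrict p w))
  quiescent⇒even {w} lw qw p with sequential-even-or-open (lw p)
  ... | inj₁ even = even
  ... | inj₂ (w' , a , eq , k) with filter-occurrence (of? p) w w' eq
  ...   | u , v , refl , rv≡[] , pa = ⊥-elim (qw u a v refl (k , no-response))
    where
    -- every response to a belongs to process p, but p has no events in v
    no-response : ¬ Any (Matches a) v
    no-response m with filter⁺ (of? p) m
    ... | inj₁ m' = ¬Any[] (subst (Any (Matches a)) rv≡[] m')
    ... | inj₂ ¬p = ¬p (trans (sym (proj₁ (proj₂ (proj₂ (lookup-result m))))) pa)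

  -- ... while a pending invocation leaves its process with an odd number.
  pending⇒odd : Legal (u ++ a ∷ v) → Pending u a v → Odd (length (restrict (proc a) (u ++ a ∷ v)))
  pending⇒odd {u} {a} {v} l (k , nm) =
    subst (λ r → Odd (length r)) (sym restrict-split)
      (sequential-pending-odd (restrict p u)
        (subst Sequential restrict-split (l p)) k (λ m → nm (filter⁻ (of? p) m)))
    where
    p : Proc
    p = proc a
    restrict-split : restrict p (u ++ a ∷ v) ≡ restrict p u ++ a ∷ restrict p v
    restrict-split = trans (filter-++ (of? p) u (a ∷ v))
                           (cong (restrict p u ++_) (filter-accept (of? p) refl))

  quiescent-↭ : Legal x → Quiescent x → x ↭ y → Legal y → Quiescent y
  quiescent-↭ lx qx x↭y ly u a v refl pending =
    even-odd-disjoint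
      (subst Even (↭-length (filter-↭ (of? (proc a)) x↭y)) (quiescent⇒even lx qx (proc a)))
      (pending⇒odd {u = u} ly pending)

  legal-suffix : Legal pre → Quiescent pre → Legal (pre ++ w) → Legal w
  legal-suffix {pre} {w} lp qp lpw p =
    sequential-drop (restrict p pre) (quiescent⇒even lp qp p)
      (subst Sequential (filter-++ (of? p) pre w) (lpw p))

  legal-[] : Legal []
  legal-[] p = []

  quiescent-[] : Quiescent []
  quiescent-[] [] _ _ ()
  quiescent-[] (_ ∷ _) _ _ ()

  quiescent-++ : Quiescent x → Quiescent y → Quiescent (x ++ y)
  quiescent-++ {x} {y} qx qy u a v eq (k , nm) with ++-overlap x y u (a ∷ v) eq
  ... | inj₁ (z , refl , y≡)           = qy z a v y≡ (k , nm)
  ... | inj₂ ([] , _ , y≡)             = qy [] a v (sym y≡) (k , nm)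
  ... | inj₂ (_ ∷ z , x≡ , refl)       = qx u a z x≡ (k , λ m → nm (++⁺ˡ m))

  quiescent-suffix : ∀ x → Quiescent (x ++ y) → Quiescent y
  quiescent-suffix x q u a v eq = q (x ++ u) a v (trans (cong (x ++_) eq) (sym (++-assoc x u (a ∷ v))))

  FirstQuiescence : List Event → List Event → Set
  FirstQuiescence pre b = ∀ u₁ u₂ → b ≡ u₁ ++ u₂ → u₁ ≢ [] → u₂ ≢ [] → ¬ Quiescent (pre ++ u₁)

  first-quiescence-[] : FirstQuiescence pre []
  first-quiescence-[] u₁ u₂ eq ne₁ _ _ = ne₁ (++-conicalˡ u₁ u₂ (sym eq))

  first-quiescence-[_] : ∀ a → FirstQuiescence pre [ a ]
  first-quiescence-[ a ] []       _  _  ne₁ _   _ = ne₁ refl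
  first-quiescence-[ a ] (_ ∷ u₁) u₂ eq _   ne₂ _ = ne₂ (++-conicalʳ u₁ u₂ (sym (∷-injectiveʳ eq)))

  first-quiescence-snoc : FirstQuiescence pre u → ¬ Quiescent (pre ++ u) → FirstQuiescence pre (u ++ [ a ])
  first-quiescence-snoc {pre} {u} {a} fq nq u₁ u₂ eq ne₁ ne₂ q₁ with ++-overlap u [ a ] u₁ u₂ eq
  ... | inj₁ ([] , u₁≡ , _)         = nq (subst (λ z → Quiescent (pre ++ z)) (trans u₁≡ (++-identityʳ u)) q₁)
  ... | inj₁ (_ ∷ z , _ , a≡)       = ne₂ (++-conicalʳ z u₂ (sym (∷-injectiveʳ a≡)))
  ... | inj₂ ([] , u≡ , _)          = nq (subst (λ z → Quiescent (pre ++ z)) (sym (trans u≡ (++-identityʳ u₁))) q₁)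
  ... | inj₂ (c ∷ z , u≡ , _)       = fq u₁ (c ∷ z) u≡ ne₁ (λ ()) q₁

  first-quiescence-e2e : Quiescent pre → Quiescent (pre ++ w) → FirstQuiescence pre w → EndToEndQuiescent w
  first-quiescence-e2e {pre} qp qpw fq =
    quiescent-suffix pre qpw , λ u₁ u₂ eq ne₁ ne₂ q₁ → fq u₁ u₂ eq ne₁ ne₂ (quiescent-++ qp q₁)

  record DelimitedBlock (pre b : List Event) : Set where
    constructor delimited
    field
      legal     : Legal (pre ++ b)
      quiescent : Quiescent (pre ++ b)
      first     : FirstQuiescence pre b
  open DelimitedBlock

  delimited-[] : Legal pre → Quiescent pre → DelimitedBlock pre []
  delimited-[] {pre} lp qp =
    delimited (subst Legal pre≡ lp) (subst Quiescent pre≡ qp) first-quiescence-[]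
    where
    pre≡ : pre ≡ pre ++ []
    pre≡ = sym (++-identityʳ pre)

  delimited-allowed : ∀ {bs} → Legal pre → Quiescent pre → Blockwise DelimitedBlock pre bs →
    All (λ b → Legal b × EndToEndQuiescent b) bs
  delimited-allowed lp qp []       = []
  delimited-allowed lp qp (d ∷ ds) =
    (legal-suffix lp qp (legal d) , first-quiescence-e2e qp (quiescent d) (first d))
      ∷ delimited-allowed (legal d) (quiescent d) ds

  LegalQuiescent : List Event → Set
  LegalQuiescent w = Legal w × Quiescent w

  delimited-whole : ∀ {b bs} → Blockwise DelimitedBlock pre (b ∷ bs) → LegalQuiescent (pre ++ concat (b ∷ bs))
  delimited-whole {pre} {b} (d ∷ []) =
    subst LegalQuiescent (cong (pre ++_) (sym (++-identityʳ b))) (legal d , quiescent d)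
  delimited-whole {pre} {b} (d ∷ ds@(_ ∷ _)) =
    subst LegalQuiescent (++-assoc pre b _) (delimited-whole ds)

  QuiescentIfLegal : List Event → List Event → Set
  QuiescentIfLegal pre c = Legal (pre ++ c) → Quiescent (pre ++ c)

  delimited-↭ : ∀ {preB preC bs cs} → Blockwise DelimitedBlock preB bs → preB ↭ preC →
    Pointwise _↭_ bs cs → Blockwise QuiescentIfLegal preC cs
  delimited-↭ []       _ []       = []
  delimited-↭ (d ∷ ds) p (q ∷ qs) =
    quiescent-↭ (legal d) (quiescent d) (++⁺ p q) ∷ delimited-↭ ds (++⁺ p q) qs

  e2e-prefix-unique : ∀ {b d} → EndToEndQuiescent b → EndToEndQuiescent d → b ≢ [] → d ≢ [] →
    b ++ x ≡ d ++ y → b ≡ d × x ≡ y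
  e2e-prefix-unique {b = b} {d} eb ed nb nd eq with ++-overlap b _ d _ eq
  ... | inj₁ ([] , d≡ , x≡)    = sym (trans d≡ (++-identityʳ b)) , x≡
  ... | inj₁ (c ∷ z , d≡ , _)  = ⊥-elim (proj₂ ed b (c ∷ z) d≡ nb (λ ()) (proj₁ eb))
  ... | inj₂ ([] , b≡ , y≡)    = trans b≡ (++-identityʳ d) , sym y≡
  ... | inj₂ (c ∷ z , b≡ , _)  = ⊥-elim (proj₂ eb d (c ∷ z) b≡ nd (λ ()) (proj₁ ed))

  -- Two end-to-end quiescent decompositions of one word agree up to empty
  -- blocks, so a blockwise permutation of one transfers to the other.
  align : ∀ bs ds {ds'} → concat bs ≡ concat ds → All EndToEndQuiescent bs → All EndToEndQuiescent ds →
    Pointwise _↭_ ds ds' → ∃[ cs ] (Pointwise _↭_ bs cs × concat cs ≡ concat ds')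
  align [] ds eq _ _ pw =
    [] , [] , sym (↭-empty-inv (subst (_ ↭_) (sym eq) (↭-sym (concat-↭ pw))))
  align ([] ∷ bs) ds eq (_ ∷ ebs) eds pw =
    let (cs , bs↭cs , cs≡) = align bs ds eq ebs eds pw in [] ∷ cs , ↭-refl ∷ bs↭cs , cs≡
  align ((_ ∷ _) ∷ bs) [] () _ _ _
  align bs@((_ ∷ _) ∷ _) ([] ∷ ds) eq ebs (_ ∷ eds) (p ∷ pw) with ↭-empty-inv (↭-sym p)
  ... | refl = align bs ds eq ebs eds pw
  align ((c ∷ b) ∷ bs) ((e ∷ d) ∷ ds) eq (eb ∷ ebs) (ed ∷ eds) (_∷_ {y = d'} p pw)
    with e2e-prefix-unique eb ed (λ ()) (λ ()) eq
  ... | refl , rest≡ =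
    let (cs , bs↭cs , cs≡) = align bs ds rest≡ ebs eds pw in d' ∷ cs , p ∷ bs↭cs , cong (d' ++_) cs≡

  eraseδ-blocks : ∀ x → eraseδ x ≡ concat (blocks x)
  eraseδ-blocks []         = refl
  eraseδ-blocks (ev a ∷ x) = cong (a ∷_) (eraseδ-blocks x)
  eraseδ-blocks (δ ∷ x)    = eraseδ-blocks x

  module QδRuns (Q : FinAut Event) (legalQ : AllRunsLegal Q) (quiescentQ : PathQuiescentIffFinal Q) where
    open FinAut Q using (init)
    QA : Automaton Event
    QA = FinAut.aut Q

    quiescent-state : ∀ {q} → Path QA init w q → QuiescentState QA q → Quiescent w
    quiescent-state p (_ , p₀ , q₀) =
      Equivalence.from (quiescentQ p) (Equivalence.to (quiescentQ p₀) q₀)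

    -- Reading x from the state reached by pre ++ u, where u is the current
    -- block so far: the blocks of u ++ x are delimited.
    analyse : ∀ pre u {q x f} → Path QA init (pre ++ u) q → Quiescent pre → FirstQuiescence pre u →
      Path (Qδ Q) (inj₁ q) x f → Automaton.Final (Qδ Q) f →
      Blockwise DelimitedBlock pre ((u ++ proj₁ (splitδ x)) ∷ proj₂ (splitδ x))
    analyse pre u pu qp fq [] (final , ¬qs) =
      ⊥-elim (¬qs (pre ++ u , pu , Equivalence.from (quiescentQ pu) final))
    analyse pre u {x = ev a ∷ x} pu qp fq (_∷_ {q' = inj₁ _} (¬qs , t) p) fin =
      subst (Blockwise DelimitedBlock pre) (cong (_∷ _) (++-assoc u [ a ] _))
        (analyse pre (u ++ [ a ])
          (subst (λ w → Path QA init w _) (++-assoc pre u [ a ]) (path-++ pu (t ∷ [])))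
          qp (first-quiescence-snoc fq (λ q → ¬qs (_ , pu , q))) p fin)
    analyse pre u {x = ev a ∷ x} pu qp fq (_∷_ {q' = inj₂ _} () p) fin
    analyse pre u {x = δ ∷ x} pu qp fq (_∷_ {q' = inj₁ _} () p) fin
    analyse pre u {x = δ ∷ x} pu qp fq (_∷_ {q' = inj₂ _} (qs , refl) p) fin
      rewrite ++-identityʳ u = delimited lpu qpu fq ∷ after-δ p fin
      where
      lpu : Legal (pre ++ u)
      lpu = legalQ _ (_ , pu)
      qpu : Quiescent (pre ++ u)
      qpu = quiescent-state pu qs
      after-δ : ∀ {x f} → Path (Qδ Q) (inj₂ _) x f → Automaton.Final (Qδ Q) f →
        Blockwise DelimitedBlock (pre ++ u) (blocks x)
      after-δ [] _ = delimited-[] lpu qpu ∷ []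
      after-δ (_∷_ {a = ev a} {q' = inj₁ _} (_ , t) p) fin =
        analyse (pre ++ u) [ a ] (path-++ pu (t ∷ [])) qpu first-quiescence-[ a ] p fin
      after-δ (_∷_ {a = ev a} {q' = inj₂ _} () p) fin
      after-δ (_∷_ {a = δ} {q' = inj₁ _} () p) fin
      after-δ (_∷_ {a = δ} {q' = inj₂ _} () p) fin

    -- An accepted run of Q_δ starts with δ in the quiescent initial state.
    delimited-run : ∀ {σ} → Lang (Qδ Q) σ → Blockwise DelimitedBlock [] (blocks σ)
    delimited-run (_ , p , fin) = analyse [] [] [] quiescent-[] first-quiescence-[] p fin

  module SδRuns (S : FinAut Event) (legalS : AllRunsLegal S) where
    open FinAut S using (init)
    SA : Automaton Event
    SA = FinAut.aut S

    erase-path : ∀ {s x f} → Path (Sδ S) s x f → Path SA s (eraseδ x) f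
    erase-path []                           = []
    erase-path (_∷_ {a = ev a} t p)        = t ∷ erase-path p
    erase-path (_∷_ {a = δ} (refl , _) p)  = erase-path p

    ▸-path : ∀ {q q₁ f b r} → Path SA q b q₁ → Path (Sδ S) q₁ r f → Path (Sδ S) q (b ▸ r) f
    ▸-path []       p = p
    ▸-path (t ∷ p₁) p = t ∷ ▸-path p₁ p

    lift-δ : ∀ {pre q qf} cs → Path SA init pre q → Quiescent pre → Path SA q (concat cs) qf →
      Blockwise QuiescentIfLegal pre cs → Path (Sδ S) q (δ-unblocks cs) qf
    lift-δ []       _  _  [] [] = []
    lift-δ (c ∷ cs) pp qp p (qc ∷ qcs) with path-split c p
    ... | _ , p₁ , p₂ =
      let pp₁ = path-++ pp p₁ in
      (refl , (_ , pp , qp)) ∷ ▸-path p₁ (lift-δ cs pp₁ (qc (legalS _ (_ , pp₁))) p₂ qcs)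

    lift-path : ∀ {qf} cs → Path SA init (concat cs) qf → Blockwise QuiescentIfLegal [] cs →
      Path (Sδ S) init (unblocks cs) qf
    lift-path []       [] []  = []
    lift-path (c ∷ cs) p qcs with lift-δ (c ∷ cs) [] quiescent-[] p qcs
    ... | (refl , _) ∷ path = path

mainTheorem5 : (E : EventSig) → (S Q : FinAut (EventSig.Event E)) →
    Events.Assumptions E S Q →
    (σ : List (Ext (EventSig.Event E))) →
    Lang (Events.Qδ E Q) σ →
    Events.AllowedQCδ E S σ ⇔ LangU (Events.Sδ E S) σ
mainTheorem5 E S Q As σ σ∈Qδ = mk⇔ allowed⇒reduced reduced⇒allowed
  where
  open Events E
  open EventTheory E
  open Assumptions As
  open QδRuns Q Q-legal Q-quiescent using (delimited-run)
  open SδRuns S S-legal using (erase-path; lift-path)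

  σ-delimited : Blockwise DelimitedBlock [] (blocks σ)
  σ-delimited = delimited-run σ∈Qδ

  σ≡blocks : eraseδ σ ≡ concat (blocks σ)
  σ≡blocks = eraseδ-blocks σ

  blocks-allowed : All (λ b → Legal b × EndToEndQuiescent b) (blocks σ)
  blocks-allowed = delimited-allowed legal-[] quiescent-[] σ-delimited

  σ-legal-quiescent : LegalQuiescent (eraseδ σ)
  σ-legal-quiescent = subst LegalQuiescent (sym σ≡blocks) (delimited-whole σ-delimited)

  -- (⇐): erase δ from the S_δ-run and undo the swaps blockwise
  reduced⇒allowed : LangU (Sδ S) σ → AllowedQCδ S σ
  reduced⇒allowed (w₀ , (f , p , fin) , w₀↝σ) =
    proj₁ σ-legal-quiescent , proj₂ σ-legal-quiescent , blocks σ , sym σ≡blocks , blocks-allowed ,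
    blocks w₀ , Pointwise.symmetric ↭-sym (swaps-blockwise w₀↝σ) ,
    f , subst (λ w → Path (FinAut.aut S) (FinAut.init S) w f) (eraseδ-blocks w₀) (erase-path p) , fin

  -- (⇒): align the witnessing decomposition with the blocks of σ, lift the
  -- permuted S-run to S_δ and swap it back into σ
  allowed⇒reduced : AllowedQCδ S σ → LangU (Sδ S) σ
  allowed⇒reduced (_ , _ , ds , ds≡σ , ds-allowed , ds' , ds↭ds' , f , p , fin)
    with align (blocks σ) ds (trans (sym σ≡blocks) (sym ds≡σ))
               (All.map proj₂ blocks-allowed) (All.map proj₂ ds-allowed) ds↭ds'
  ... | cs , bs↭cs , cs≡ds' =
    unblocks cs ,
    (f , lift-path cs (subst (λ w → Path (FinAut.aut S) (FinAut.init S) w f) (sym cs≡ds') p)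
                      (delimited-↭ σ-delimited ↭-refl bs↭cs) , fin) ,
    subst (Star SwapStep (unblocks cs)) (unblocks-blocks σ) (blockwise-swaps (Pointwise.symmetric ↭-sym bs↭cs))
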